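{- Let $(j_n)_{n\ge 0}$ be defined by $j_0=0$, $j_{2k}=j_k$ and $j_{2k+1}=(-1)^k$ for all $k\ge 0$, and let $s_n=1+\sum_{0\le k\le n}j_k$. Then for all $n\ge 0$: $s_{2n}=s_n$ if $n$ is even and $s_{2n}=s_n+1$ if $n$ is odd; and $s_{2n+1}=s_n+1$ if $n$ is even and $s_{2n+1}=s_n$ if $n$ is odd. -}

module Defs where

open import Data.Nat using (ℕ; zero; suc; _/_; _%_)
open import Data.Integer using (ℤ; +_; -_; _+_)

sgn : ℕ → ℤ
sgn zero = + 1
sgn (suc k) = - sgn k

-- j with fuel: the fuel argument only ensures termination; with
-- fuel ≥ n the value is the paper's j_n (j_0 = 0, j_{2k} = j_k,
-- j_{2k+1} = (-1)^k).
jAux : ℕ → ℕ → ℤ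
jAux zero n = + 0
jAux (suc f) zero = + 0
jAux (suc f) (suc m) with (suc m) % 2
... | zero = jAux f (suc m / 2)
... | suc _ = sgn (suc m / 2)

j : ℕ → ℤ
j n = jAux n n

sumJ : ℕ → ℤ
sumJ zero = j 0
sumJ (suc n) = sumJ n + j (suc n)

s : ℕ → ℤ
s n = + 1 + sumJ n

open import Data.Nat using (_*_) renaming (_+_ to _+ℕ_)
open import Data.Product using (∃)
open import Relation.Binary.PropositionalEquality using (_≡_)

Even : ℕ → Set
Even n = ∃ λ k → n ≡ 2 * k

Odd : ℕ → Set
Odd n = ∃ λ k → n ≡ 2 * k +ℕ 1

{-# OPTIONS --safe #-}
-- Split Σ_{k ≤ 2n+1} j_k by the parity of k: the even terms j_{2k} = j_k
-- give Σ_{k ≤ n} j_k, and the odd terms j_{2k+1} = (-1)^k give the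
-- alternating sum Σ_{k ≤ n} (-1)^k, which is 1 for even n and 0 for odd n.
-- Dropping the last term j_{2n+1} = (-1)^n gives the sum up to 2n.
module Submission where

open import Defs
open import Function using (_∘_)
open import Data.Nat using (ℕ; zero; suc; pred; _*_; _/_; _%_; _≤_; s≤s; z≤n) renaming (_+_ to _+ℕ_)
import Data.Nat.Properties as ℕ
open import Data.Nat.DivMod using (m*n%n≡0; m*n/n≡m; [m+kn]%n≡m%n; +-distrib-/-∣ʳ; m/n<m)
open import Data.Nat.Divisibility using (m∣m*n)
open import Data.Integer using (ℤ; +_; -_) renaming (_+_ to _+ℤ_; _-_ to _-ℤ_)
import Data.Integer.Properties as ℤ
open import Data.Integer.Tactic.RingSolver using (solve-∀)
open import Data.Product using (_×_; _,_)
open import Relation.Binary.PropositionalEquality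
open ≡-Reasoning

2*k%2≡0 : ∀ k → 2 * k % 2 ≡ 0
2*k%2≡0 k = trans (cong (_% 2) (ℕ.*-comm 2 k)) (m*n%n≡0 k 2)

2*k/2≡k : ∀ k → 2 * k / 2 ≡ k
2*k/2≡k k = trans (cong (_/ 2) (ℕ.*-comm 2 k)) (m*n/n≡m k 2)

[1+2*k]%2≡1 : ∀ k → suc (2 * k) % 2 ≡ 1
[1+2*k]%2≡1 k = trans (cong (λ m → suc m % 2) (ℕ.*-comm 2 k)) ([m+kn]%n≡m%n 1 k 2)

[1+2*k]/2≡k : ∀ k → suc (2 * k) / 2 ≡ k
[1+2*k]/2≡k k = trans (+-distrib-/-∣ʳ 1 {d = 2} (m∣m*n k)) (2*k/2≡k k)

2*k+1≡1+2*k : ∀ k → 2 * k +ℕ 1 ≡ suc (2 * k)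
2*k+1≡1+2*k k = ℕ.+-comm (2 * k) 1

jAux-fuel-irrelevant : ∀ f g n → n ≤ f → n ≤ g → jAux f n ≡ jAux g n
jAux-fuel-irrelevant zero    zero    n       _         _         = refl
jAux-fuel-irrelevant zero    (suc g) zero    _         _         = refl
jAux-fuel-irrelevant (suc f) zero    zero    _         _         = refl
jAux-fuel-irrelevant (suc f) (suc g) zero    _         _         = refl
jAux-fuel-irrelevant (suc f) (suc g) (suc m) (s≤s m≤f) (s≤s m≤g) with suc m % 2
... | zero  = jAux-fuel-irrelevant f g (suc m / 2) (ℕ.≤-trans half≤m m≤f) (ℕ.≤-trans half≤m m≤g)
  where
  half≤m : suc m / 2 ≤ m
  half≤m = ℕ.≤-pred (m/n<m (suc m) 2 (s≤s (s≤s z≤n)))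
... | suc _ = refl

jAux-suc-even : ∀ f m → suc m % 2 ≡ 0 → jAux (suc f) (suc m) ≡ jAux f (suc m / 2)
jAux-suc-even f m even with suc m % 2
... | zero = refl
jAux-suc-even f m () | suc _

jAux-suc-odd : ∀ f m → suc m % 2 ≡ 1 → jAux (suc f) (suc m) ≡ sgn (suc m / 2)
jAux-suc-odd f m odd with suc m % 2
jAux-suc-odd f m () | zero
... | suc _ = refl

j-double : ∀ k → j (2 * k) ≡ j k
j-double zero    = refl
j-double (suc k) = begin
  jAux (suc m) (2 * suc k)   ≡⟨ jAux-suc-even m m (2*k%2≡0 (suc k)) ⟩
  jAux m (2 * suc k / 2)     ≡⟨ cong (jAux m) (2*k/2≡k (suc k)) ⟩
  jAux m (suc k)             ≡⟨ jAux-fuel-irrelevant m (suc k) (suc k) 1+k≤m ℕ.≤-refl ⟩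
  j (suc k)                  ∎
  where
  m : ℕ
  m = pred (2 * suc k)
  1+k≤m : suc k ≤ m
  1+k≤m = subst (suc k ≤_) (sym (ℕ.+-suc k (k +ℕ 0))) (s≤s (ℕ.m≤m+n k (k +ℕ 0)))

j-double+1 : ∀ k → j (suc (2 * k)) ≡ sgn k
j-double+1 k = trans (jAux-suc-odd (2 * k) (2 * k) ([1+2*k]%2≡1 k)) (cong sgn ([1+2*k]/2≡k k))

sumSgn : ℕ → ℤ
sumSgn zero    = + 1
sumSgn (suc n) = sumSgn n +ℤ sgn (suc n)

sumJ-double+1 : ∀ n → sumJ (suc (2 * n)) ≡ sumJ n +ℤ sumSgn n
sumJ-double+1 zero    = refl
sumJ-double+1 (suc n) = begin
  sumJ (pred (2 * suc n)) +ℤ j (2 * suc n) +ℤ j (suc (2 * suc n))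
    ≡⟨ cong (λ t → t +ℤ j (2 * suc n) +ℤ j (suc (2 * suc n)))
            (trans (cong sumJ (ℕ.+-suc n (n +ℕ 0))) (sumJ-double+1 n)) ⟩
  sumJ n +ℤ sumSgn n +ℤ j (2 * suc n) +ℤ j (suc (2 * suc n))
    ≡⟨ cong₂ (λ a b → sumJ n +ℤ sumSgn n +ℤ a +ℤ b) (j-double (suc n)) (j-double+1 (suc n)) ⟩
  sumJ n +ℤ sumSgn n +ℤ j (suc n) +ℤ sgn (suc n)
    ≡⟨ interchange (sumJ n) (sumSgn n) (j (suc n)) (sgn (suc n)) ⟩
  sumJ n +ℤ j (suc n) +ℤ (sumSgn n +ℤ sgn (suc n))
    ∎
  where
  interchange : ∀ a b c d → a +ℤ b +ℤ c +ℤ d ≡ a +ℤ c +ℤ (b +ℤ d)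
  interchange = solve-∀

sumJ-double : ∀ n → sumJ (2 * n) ≡ sumJ n +ℤ (sumSgn n -ℤ sgn n)
sumJ-double n = begin
  sumJ (2 * n)                                ≡⟨ add-sub (sumJ (2 * n)) (sgn n) ⟩
  sumJ (2 * n) +ℤ sgn n -ℤ sgn n              ≡⟨ cong (λ t → sumJ (2 * n) +ℤ t -ℤ sgn n) (sym (j-double+1 n)) ⟩
  sumJ (suc (2 * n)) -ℤ sgn n                 ≡⟨ cong (_-ℤ sgn n) (sumJ-double+1 n) ⟩
  sumJ n +ℤ sumSgn n -ℤ sgn n                 ≡⟨ ℤ.+-assoc (sumJ n) (sumSgn n) (- sgn n) ⟩
  sumJ n +ℤ (sumSgn n -ℤ sgn n)               ∎
  where
  add-sub : ∀ a b → a ≡ a +ℤ b -ℤ b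
  add-sub = solve-∀

s-double : ∀ n → s (2 * n) ≡ s n +ℤ (sumSgn n -ℤ sgn n)
s-double n = trans (cong (+ 1 +ℤ_) (sumJ-double n)) (sym (ℤ.+-assoc (+ 1) (sumJ n) _))

s-double+1 : ∀ n → s (2 * n +ℕ 1) ≡ s n +ℤ sumSgn n
s-double+1 n = begin
  s (2 * n +ℕ 1)             ≡⟨ cong s (2*k+1≡1+2*k n) ⟩
  + 1 +ℤ sumJ (suc (2 * n))  ≡⟨ cong (+ 1 +ℤ_) (sumJ-double+1 n) ⟩
  + 1 +ℤ (sumJ n +ℤ sumSgn n) ≡⟨ ℤ.+-assoc (+ 1) (sumJ n) (sumSgn n) ⟨
  s n +ℤ sumSgn n            ∎

sgn-double : ∀ k → sgn (2 * k) ≡ + 1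
sgn-double zero    = refl
sgn-double (suc k) = begin
  sgn (2 * suc k)        ≡⟨ cong sgn (ℕ.*-suc 2 k) ⟩
  - - sgn (2 * k)        ≡⟨ ℤ.neg-involutive (sgn (2 * k)) ⟩
  sgn (2 * k)            ≡⟨ sgn-double k ⟩
  + 1                    ∎

sgn-even : ∀ {n} → Even n → sgn n ≡ + 1
sgn-even (k , refl) = sgn-double k

sgn-odd : ∀ {n} → Odd n → sgn n ≡ - + 1
sgn-odd (k , refl) = trans (cong sgn (2*k+1≡1+2*k k)) (cong -_ (sgn-double k))

sumSgn-suc-suc : ∀ n → sumSgn (suc (suc n)) ≡ sumSgn n
sumSgn-suc-suc n = begin
  sumSgn n +ℤ - sgn n +ℤ - - sgn n  ≡⟨ cong (sumSgn n +ℤ - sgn n +ℤ_) (ℤ.neg-involutive (sgn n)) ⟩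
  sumSgn n +ℤ - sgn n +ℤ sgn n      ≡⟨ sub-add (sumSgn n) (sgn n) ⟩
  sumSgn n                          ∎
  where
  sub-add : ∀ a b → a -ℤ b +ℤ b ≡ a
  sub-add = solve-∀

sumSgn-double : ∀ k → sumSgn (2 * k) ≡ + 1
sumSgn-double zero    = refl
sumSgn-double (suc k) = trans (cong sumSgn (ℕ.*-suc 2 k))
                              (trans (sumSgn-suc-suc (2 * k)) (sumSgn-double k))

sumSgn-double+1 : ∀ k → sumSgn (suc (2 * k)) ≡ + 0
sumSgn-double+1 zero    = refl
sumSgn-double+1 (suc k) = trans (cong (sumSgn ∘ suc) (ℕ.*-suc 2 k))
                                (trans (sumSgn-suc-suc (suc (2 * k))) (sumSgn-double+1 k))

sumSgn-even : ∀ {n} → Even n → sumSgn n ≡ + 1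
sumSgn-even (k , refl) = sumSgn-double k

sumSgn-odd : ∀ {n} → Odd n → sumSgn n ≡ + 0
sumSgn-odd (k , refl) = trans (cong sumSgn (2*k+1≡1+2*k k)) (sumSgn-double+1 k)

proposition1 : (n : ℕ) →
    (Even n → s (2 * n) ≡ s n) ×
    (Odd n → s (2 * n) ≡ s n +ℤ + 1) ×
    (Even n → s (2 * n +ℕ 1) ≡ s n +ℤ + 1) ×
    (Odd n → s (2 * n +ℕ 1) ≡ s n)
proposition1 n = even-double , odd-double , even-double+1 , odd-double+1
  where
  even-double : Even n → s (2 * n) ≡ s n
  even-double e = begin
    s (2 * n)                         ≡⟨ s-double n ⟩
    s n +ℤ (sumSgn n -ℤ sgn n)        ≡⟨ cong₂ (λ a b → s n +ℤ (a -ℤ b)) (sumSgn-even e) (sgn-even e) ⟩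
    s n +ℤ + 0                        ≡⟨ ℤ.+-identityʳ (s n) ⟩
    s n                               ∎

  odd-double : Odd n → s (2 * n) ≡ s n +ℤ + 1
  odd-double o = trans (s-double n) (cong₂ (λ a b → s n +ℤ (a -ℤ b)) (sumSgn-odd o) (sgn-odd o))

  even-double+1 : Even n → s (2 * n +ℕ 1) ≡ s n +ℤ + 1
  even-double+1 e = trans (s-double+1 n) (cong (s n +ℤ_) (sumSgn-even e))

  odd-double+1 : Odd n → s (2 * n +ℕ 1) ≡ s n
  odd-double+1 o = trans (s-double+1 n) (trans (cong (s n +ℤ_) (sumSgn-odd o)) (ℤ.+-identityʳ (s n)))
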